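{- Let $n\ge1$ and let $x<y<z$ be consecutive elements of $\Xi_n$ with $y\in\Theta_n$. Then $x\oplus y\in\Theta_{n+2}$ and $y\oplus z\in\Theta_{n+1}$.
   Context: The mediant of reduced fractions is $\frac{a}{b}\oplus\frac{c}{d}=\frac{a+c}{b+d}$ (with $0=\frac01$, $1=\frac11$). Every rational $x\in(0,1)$ has a unique regular reduced continued fraction expansion $x = [[1;b_1,\ldots,b_l]] = 1-\cfrac{1}{b_1-\cfrac{1}{b_2-\cdots-\cfrac{1}{b_l}}}$ with integers $b_i\ge 2$; put $L(x)=b_1+\cdots+b_l$. For $k\ge1$, $\Theta_k=\{x\in\mathbb{Q}\cap(0,1): L(x)=k+1\}$, and $\Xi_n=\{0,1\}\cup\bigcup_{k=1}^n\Theta_k$, ordered increasingly. -}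

module Defs where

open import Data.Nat as ℕ using (ℕ; suc; _≤_; _∸_)
open import Data.Integer as ℤ using (ℤ; +_)
open import Data.Rational using (ℚ; ↥_; ↧_; ↧ₙ_; _/_; _<_; 0ℚ; 1ℚ)
open import Data.List using (List; []; _∷_)
open import Data.Nat.ListAction using (sum)
open import Data.List.Relation.Unary.All using (All)
open import Data.Product using (_×_; Σ; ∃; _,_; proj₁; proj₂)
open import Data.Sum using (_⊎_)
open import Relation.Binary.PropositionalEquality using (_≡_)
open import Relation.Nullary using (¬_)

-- Mediant of reduced fractions a/b ⊕ c/d = (a+c)/(b+d).
-- (Elements of ℚ are stored in reduced form; b + d is written as
--  suc (denominator-1 x + d) so that the NonZero instance is found.)
_⊕_ : ℚ → ℚ → ℚ
x ⊕ y = (↥ x ℤ.+ ↥ y) / suc (ℚ.denominator-1 x ℕ.+ ↧ₙ y)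

-- Value of the finite "minus" continued fraction
--   b₁ - 1/(b₂ - 1/(… - 1/b_l))
-- as a pair (p , q) meaning p/q (for entries ≥ 2 one has p > q ≥ 1,
-- so the truncated subtraction below is genuine subtraction).
-- The value of the empty list is irrelevant (never used: expansions are nonempty).
cfPair : List ℕ → ℕ × ℕ
cfPair []           = (1 , 0)
cfPair (b ∷ [])     = (b , 1)
cfPair (b ∷ bs@(_ ∷ _)) = (b ℕ.* proj₁ (cfPair bs) ∸ proj₂ (cfPair bs) , proj₁ (cfPair bs))

-- x = [[1; b₁,…,b_l]] = 1 - 1/(b₁ - 1/(b₂ - … - 1/b_l)) = (p - q)/p
-- where cfPair bs = (p , q); stated by cross-multiplication.
IsExpansion : ℚ → List ℕ → Set
IsExpansion x [] = Data.Empty.⊥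
  where import Data.Empty
IsExpansion x bs@(_ ∷ _) =
  All (2 ≤_) bs × (↥ x ℤ.* + proj₁ (cfPair bs) ≡ + (proj₁ (cfPair bs) ∸ proj₂ (cfPair bs)) ℤ.* ↧ x)

Θ : ℕ → ℚ → Set
Θ k x = (0ℚ < x) × (x < 1ℚ) × ∃ λ bs → IsExpansion x bs × (sum bs ≡ suc k)

Ξ : ℕ → ℚ → Set
Ξ n x = (x ≡ 0ℚ) ⊎ (x ≡ 1ℚ) ⊎ ∃ λ k → (1 ≤ k) × (k ≤ n) × Θ k x

ConsecutiveIn : ℕ → ℚ → ℚ → Set
ConsecutiveIn n x y = Ξ n x × Ξ n y × (x < y) × (∀ w → Ξ n w → ¬ ((x < w) × (w < y)))

-- A pair (p , q) with q ≤ p stands for the rational (p − q)/p, and step b (p , q) = (b p − q , p)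
-- prepends the entry b to an expansion, so cfPair bs = foldr step (1 , 0) bs; replacing the
-- terminal pair (1 , 0) by (1 , 1) lowers the last entry by one.  Let y = [[1; b₁,…,b_l]] ∈ Θ n.
-- Since step preserves the determinant p q′ − p′ q, the pair of y has determinant one with the
-- pairs of (b₁,…,b_l − 1) and of (b₁,…,b_{l−1}); hence all three are reduced and in increasing order.
-- The first entry of an expansion is the ceiling of p/q, so an expansion lying strictly between
-- two pairs with a common prefix must begin with that prefix; this pushes the entry sum of every
-- rational strictly between y and these candidates above n + 1, so they are y's neighbours in Ξ n.
-- Since step is additive, the mediants are the pairs of (b₁,…,b_l,2) and (b₁,…,b_l + 1).
module Submission where

open import Defs
open import Data.Nat using (ℕ; zero; suc; _+_; _*_; _∸_; _≤_; _<_; z≤n; s≤s)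
open import Data.Nat.Properties
open import Data.Nat.Divisibility using (_∣_; ∣m+n∣m⇒∣n; ∣m⇒∣m*n; ∣n⇒∣m*n; ∣1⇒≡1)
open import Data.Nat.Coprimality using (Coprime)
open import Data.Nat.ListAction using (sum)
open import Data.Nat.ListAction.Properties using (sum-++)
open import Data.Nat.Tactic.RingSolver using (solve-∀)
open import Data.Integer as ℤ using (+_)
import Data.Integer.Properties as ℤP
open import Data.Rational as ℚ using (ℚ; mkℚ; ↥_; ↧ₙ_; _/_; 0ℚ; 1ℚ)
open import Data.Rational.Unnormalised using (mkℚᵘ; *≡*)
open import Data.Rational.Properties as ℚP using (fromℚᵘ-toℚᵘ; fromℚᵘ-cong; normalize-coprime)
open import Data.List using ([]; _∷_; _++_; _∷ʳ_; foldr; InitLast; initLast; _∷ʳ′_)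
open import Data.List.Properties using (foldr-∷ʳ)
open import Data.List.Relation.Unary.All as All using (All; []; _∷_)
open import Data.List.Relation.Unary.All.Properties using (++⁻ʳ; ∷ʳ⁻; ∷ʳ⁺)
open import Data.Product using (_×_; ∃; ∃₂; _,_; proj₁; proj₂)
open import Data.Sum using (_⊎_; inj₁; inj₂)
open import Data.Empty using (⊥-elim)
open import Function.Bundles using (_⇔_; mk⇔; Equivalence)
open import Function.Properties.Equivalence as ⇔ using ()
open import Relation.Nullary using (¬_)
open import Relation.Binary.Definitions using (tri<; tri≈; tri>)
open import Relation.Binary.PropositionalEquality
open import Algebra.Properties.CommutativeSemigroup +-commutativeSemigroup using () renaming (interchange to +-interchange)
open import Algebra.Properties.CommutativeSemigroup *-commutativeSemigroup using () renaming (xy∙z≈xz∙y to *-rightComm)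

open Equivalence using (to; from)

-- Pairs and the step map

step : ℕ → ℕ × ℕ → ℕ × ℕ
step b u = (b * proj₁ u ∸ proj₂ u , proj₁ u)

0ₚ 1ₚ : ℕ × ℕ
0ₚ = (1 , 1)
1ₚ = (1 , 0)

_+ₚ_ : ℕ × ℕ → ℕ × ℕ → ℕ × ℕ
(p , q) +ₚ (p′ , q′) = (p + p′ , q + q′)

_≺_ : ℕ × ℕ → ℕ × ℕ → Set
(p , q) ≺ (p′ , q′) = p * q′ < p′ * q

Unimodular : ℕ × ℕ → ℕ × ℕ → Set
Unimodular (p , q) (p′ , q′) = p * q′ + 1 ≡ p′ * q

Admissible : ℕ × ℕ → Set
Admissible (p , q) = q ≤ p × 0 < p

Reduced : ℕ × ℕ → Set
Reduced (p , q) = Coprime (p ∸ q) p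

0ₚ-admissible : Admissible 0ₚ
0ₚ-admissible = ≤-refl , s≤s z≤n

1ₚ-admissible : Admissible 1ₚ
1ₚ-admissible = z≤n , s≤s z≤n

0ₚ-1ₚ-unimodular : Unimodular 0ₚ 1ₚ
0ₚ-1ₚ-unimodular = refl

1ₚ-maximal : ∀ {u} → ¬ 1ₚ ≺ u
1ₚ-maximal {p , q} lt = n≮0 (subst (1 * q <_) (*-zeroʳ p) lt)

admissible-≮0ₚ : ∀ {u} → Admissible u → ¬ u ≺ 0ₚ
admissible-≮0ₚ {p , q} (q≤p , _) lt = <⇒≱ (subst₂ _<_ (*-identityʳ p) (*-identityˡ q) lt) q≤p

unimodular⇒≺ : ∀ {u v} → Unimodular u v → u ≺ v
unimodular⇒≺ {p , q} {p′ , q′} det = subst (p * q′ <_) det (m<m+n (p * q′) (s≤s z≤n))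

m+n≡o+p∧m<o⇒p<n : ∀ {m n o p} → m + n ≡ o + p → m < o → p < n
m+n≡o+p∧m<o⇒p<n {m} {n} {o} {p} eq m<o = +-cancelˡ-< o p n (subst (_< o + n) eq (+-monoˡ-< n m<o))

+-∸-interchange : ∀ {m n o p} → o ≤ m → p ≤ n → (m + n) ∸ (o + p) ≡ (m ∸ o) + (n ∸ p)
+-∸-interchange {m} {n} {o} {p} o≤m p≤n = begin
  (m + n) ∸ (o + p)                       ≡⟨ cong (_∸ (o + p)) (cong₂ _+_ (sym (m∸n+n≡m o≤m)) (sym (m∸n+n≡m p≤n))) ⟩
  ((m ∸ o) + o + ((n ∸ p) + p)) ∸ (o + p) ≡⟨ cong (_∸ (o + p)) (+-interchange (m ∸ o) o (n ∸ p) p) ⟩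
  ((m ∸ o) + (n ∸ p) + (o + p)) ∸ (o + p) ≡⟨ m+n∸n≡m _ (o + p) ⟩
  (m ∸ o) + (n ∸ p)                       ∎
  where open ≡-Reasoning

-- The cross lemmas take any X, X′ with X + q = b p and X′ + q′ = b p′ so that they also apply
-- with b = 1, where X / p is the rational of (p , q).

cross-identity : ∀ {b p q p′ q′ X X′} → X + q ≡ b * p → X′ + q′ ≡ b * p′ →
                 X * p′ + q * p′ ≡ X′ * p + q′ * p
cross-identity {b} {p} {q} {p′} {q′} {X} {X′} eq eq′ = begin
  X * p′ + q * p′   ≡⟨ *-distribʳ-+ p′ X q ⟨
  (X + q) * p′      ≡⟨ cong (_* p′) eq ⟩
  b * p * p′        ≡⟨ *-rightComm b p p′ ⟩
  b * p′ * p        ≡⟨ cong (_* p) eq′ ⟨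
  (X′ + q′) * p     ≡⟨ *-distribʳ-+ p X′ q′ ⟩
  X′ * p + q′ * p   ∎
  where open ≡-Reasoning

cross-≺-iff : ∀ {b p q p′ q′ X X′} → X + q ≡ b * p → X′ + q′ ≡ b * p′ →
              X * p′ < X′ * p ⇔ (p , q) ≺ (p′ , q′)
cross-≺-iff {b} {p} {q} {p′} {q′} {X} {X′} eq eq′ = mk⇔
  (λ lt → subst₂ _<_ (*-comm q′ p) (*-comm q p′) (m+n≡o+p∧m<o⇒p<n identity lt))
  (λ lt → m+n≡o+p∧m<o⇒p<n (trans (+-comm (q′ * p) (X′ * p)) (trans (sym identity) (+-comm (X * p′) (q * p′))))
                           (subst₂ _<_ (*-comm p q′) (*-comm p′ q) lt))
  where identity = cross-identity {b} {p} {q} {p′} {q′} {X} {X′} eq eq′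

cross-unimodular : ∀ {b p q p′ q′ X X′} → X + q ≡ b * p → X′ + q′ ≡ b * p′ →
                   Unimodular (p , q) (p′ , q′) → X * p′ + 1 ≡ X′ * p
cross-unimodular {b} {p} {q} {p′} {q′} {X} {X′} eq eq′ det = +-cancelʳ-≡ (q′ * p) (X * p′ + 1) (X′ * p) (begin
  X * p′ + 1 + q′ * p     ≡⟨ cong (λ t → X * p′ + 1 + t) (*-comm q′ p) ⟩
  X * p′ + 1 + p * q′     ≡⟨ shuffle (X * p′) (p * q′) ⟩
  X * p′ + (p * q′ + 1)   ≡⟨ cong (λ t → X * p′ + t) det ⟩
  X * p′ + p′ * q         ≡⟨ cong (λ t → X * p′ + t) (*-comm p′ q) ⟩
  X * p′ + q * p′         ≡⟨ cross-identity {b} {p} {q} {p′} {q′} {X} {X′} eq eq′ ⟩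
  X′ * p + q′ * p         ∎)
  where
  open ≡-Reasoning
  shuffle : ∀ a c → a + 1 + c ≡ a + (c + 1)
  shuffle = solve-∀

step-≺-iff : ∀ b {u v} → proj₂ u ≤ b * proj₁ u → proj₂ v ≤ b * proj₁ v → step b u ≺ step b v ⇔ u ≺ v
step-≺-iff b {p , q} {p′ , q′} h h′ = cross-≺-iff {b} {p} {q} {p′} {q′} (m∸n+n≡m h) (m∸n+n≡m h′)

step-unimodular : ∀ b {u v} → proj₂ u ≤ b * proj₁ u → proj₂ v ≤ b * proj₁ v →
                  Unimodular u v → Unimodular (step b u) (step b v)
step-unimodular b {p , q} {p′ , q′} h h′ = cross-unimodular {b} {p} {q} {p′} {q′} (m∸n+n≡m h) (m∸n+n≡m h′)

step-+ : ∀ b {u v} → proj₂ u ≤ b * proj₁ u → proj₂ v ≤ b * proj₁ v → step b (u +ₚ v) ≡ step b u +ₚ step b v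
step-+ b {p , q} {p′ , q′} h h′ =
  cong (_, p + p′) (trans (cong (_∸ (q + q′)) (*-distribˡ-+ b p p′)) (+-∸-interchange h h′))

[b∸1]*p≤b*p∸q : ∀ {b p q} → 1 ≤ b → q ≤ p → (b ∸ 1) * p ≤ b * p ∸ q
[b∸1]*p≤b*p∸q {suc b} {p} {q} _ q≤p =
  m+n≤o⇒m≤o∸n (b * p) (subst (b * p + q ≤_) (+-comm (b * p) p) (+-monoʳ-≤ (b * p) q≤p))

q<p⇒p<b*p∸q : ∀ {b p q} → 2 ≤ b → q < p → p < b * p ∸ q
q<p⇒p<b*p∸q {suc (suc b)} {p} {q} _ q<p = m+n≤o⇒m≤o∸n (suc p) (begin
  suc p + q         ≡⟨ +-suc p q ⟨
  p + suc q         ≤⟨ +-monoʳ-≤ p q<p ⟩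
  p + p             ≤⟨ +-monoʳ-≤ p (m≤n*m p (suc b)) ⟩
  suc (suc b) * p   ∎)
  where open ≤-Reasoning
q<p⇒p<b*p∸q {suc zero} (s≤s ()) _

admissible⇒q≤b*p : ∀ {b u} → 2 ≤ b → Admissible u → proj₂ u ≤ b * proj₁ u
admissible⇒q≤b*p {suc b} {p , q} _ (q≤p , _) = ≤-trans q≤p (m≤m+n p (b * p))

step-admissible : ∀ {b u} → 2 ≤ b → Admissible u → Admissible (step b u)
step-admissible {suc (suc b)} {p , q} _ (q≤p , 0<p) = p≤X , <-≤-trans 0<p p≤X
  where
  p≤X : p ≤ suc (suc b) * p ∸ q
  p≤X = ≤-trans (m≤n*m p (suc b)) ([b∸1]*p≤b*p∸q {suc (suc b)} (s≤s z≤n) q≤p)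
step-admissible {suc zero} (s≤s ()) _

-- Folding step over an expansion

foldr-step-admissible : ∀ {t bs} → All (2 ≤_) bs → Admissible t → Admissible (foldr step t bs)
foldr-step-admissible []           t-adm = t-adm
foldr-step-admissible (b≥2 ∷ bs≥2) t-adm = step-admissible b≥2 (foldr-step-admissible bs≥2 t-adm)

foldr-step-unimodular : ∀ {t t′ bs} → All (2 ≤_) bs → Admissible t → Admissible t′ →
                        Unimodular t t′ → Unimodular (foldr step t bs) (foldr step t′ bs)
foldr-step-unimodular []                              _     _      det = det
foldr-step-unimodular {bs = b ∷ _} (b≥2 ∷ bs≥2) t-adm t′-adm det =
  step-unimodular b (admissible⇒q≤b*p b≥2 (foldr-step-admissible bs≥2 t-adm))
                    (admissible⇒q≤b*p b≥2 (foldr-step-admissible bs≥2 t′-adm))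
                    (foldr-step-unimodular bs≥2 t-adm t′-adm det)

foldr-step-+ : ∀ {t t′ bs} → All (2 ≤_) bs → Admissible t → Admissible t′ →
               foldr step (t +ₚ t′) bs ≡ foldr step t bs +ₚ foldr step t′ bs
foldr-step-+ []                              _     _      = refl
foldr-step-+ {bs = b ∷ _} (b≥2 ∷ bs≥2) t-adm t′-adm =
  trans (cong (step b) (foldr-step-+ bs≥2 t-adm t′-adm))
        (step-+ b (admissible⇒q≤b*p b≥2 (foldr-step-admissible bs≥2 t-adm))
                  (admissible⇒q≤b*p b≥2 (foldr-step-admissible bs≥2 t′-adm)))

cfPair≡foldr : ∀ bs → cfPair bs ≡ foldr step 1ₚ bs
cfPair≡foldr []               = refl
cfPair≡foldr (b ∷ [])         = cong (_, 1) (sym (*-identityʳ b))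
cfPair≡foldr (b ∷ bs@(_ ∷ _)) = cong (step b) (cfPair≡foldr bs)

expansion-q<p : ∀ {cs} → All (2 ≤_) cs → proj₂ (foldr step 1ₚ cs) < proj₁ (foldr step 1ₚ cs)
expansion-q<p []           = s≤s z≤n
expansion-q<p (c≥2 ∷ cs≥2) = q<p⇒p<b*p∸q c≥2 (expansion-q<p cs≥2)

expansion-in-unit-interval : ∀ {c cs} → All (2 ≤_) (c ∷ cs) →
                             0ₚ ≺ foldr step 1ₚ (c ∷ cs) × foldr step 1ₚ (c ∷ cs) ≺ 1ₚ
expansion-in-unit-interval {c} {cs} c∷cs≥2@(_ ∷ cs≥2) =
  subst₂ _<_ (sym (*-identityˡ Q)) (sym (*-identityʳ P)) (expansion-q<p c∷cs≥2) ,
  subst₂ _<_ (sym (*-zeroʳ P)) (sym (*-identityˡ Q)) (proj₂ (foldr-step-admissible cs≥2 1ₚ-admissible))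
  where
  P = proj₁ (foldr step 1ₚ (c ∷ cs))
  Q = proj₂ (foldr step 1ₚ (c ∷ cs))

expansion-unimodular : ∀ {bs} → All (2 ≤_) bs → Unimodular (foldr step 0ₚ bs) (foldr step 1ₚ bs)
expansion-unimodular bs≥2 = foldr-step-unimodular bs≥2 0ₚ-admissible 1ₚ-admissible 0ₚ-1ₚ-unimodular

∣m∸n∣m⇒∣n : ∀ {d m n} → n ≤ m → d ∣ m ∸ n → d ∣ m → d ∣ n
∣m∸n∣m⇒∣n {d} n≤m d∣m∸n d∣m = ∣m+n∣m⇒∣n (subst (d ∣_) (sym (m∸n+n≡m n≤m)) d∣m) d∣m∸n

unimodular-divisor≡1 : ∀ {d p q p′ q′} → Unimodular (p , q) (p′ , q′) → d ∣ p * q′ → d ∣ p′ * q → d ≡ 1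
unimodular-divisor≡1 {d} det d∣pq′ d∣p′q = ∣1⇒≡1 (∣m+n∣m⇒∣n (subst (d ∣_) (sym det) d∣p′q) d∣pq′)

unimodular⇒reducedˡ : ∀ {u v} → Admissible u → Unimodular u v → Reduced u
unimodular⇒reducedˡ {p , q} {p′ , q′} (q≤p , _) det (d∣p∸q , d∣p) =
  unimodular-divisor≡1 {_} {p} {q} {p′} {q′} det
    (∣m⇒∣m*n q′ d∣p) (∣n⇒∣m*n p′ (∣m∸n∣m⇒∣n q≤p d∣p∸q d∣p))

unimodular⇒reducedʳ : ∀ {u v} → Admissible v → Unimodular u v → Reduced v
unimodular⇒reducedʳ {p , q} {p′ , q′} (q′≤p′ , _) det (d∣p′∸q′ , d∣p′) =
  unimodular-divisor≡1 {_} {p} {q} {p′} {q′} det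
    (∣n⇒∣m*n p (∣m∸n∣m⇒∣n q′≤p′ d∣p′∸q′ d∣p′)) (∣m⇒∣m*n q d∣p′)

expansion-reduced : ∀ {cs} → All (2 ≤_) cs → Reduced (foldr step 1ₚ cs)
expansion-reduced {cs} cs≥2 =
  unimodular⇒reducedʳ {foldr step 0ₚ cs} (foldr-step-admissible cs≥2 1ₚ-admissible) (expansion-unimodular cs≥2)

-- Expansions lying between two pairs

≺-ratio-lower : ∀ {a p q p′ q′} → a * q ≤ p → (p , q) ≺ (p′ , q′) → a * q′ < p′
≺-ratio-lower {a} {p} {q} {p′} {q′} aq≤p lt = *-cancelʳ-< q (a * q′) p′ (begin-strict
  a * q′ * q  ≡⟨ *-rightComm a q′ q ⟩
  a * q * q′  ≤⟨ *-monoˡ-≤ q′ aq≤p ⟩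
  p * q′      <⟨ lt ⟩
  p′ * q      ∎)
  where open ≤-Reasoning

≺-ratio-upper : ∀ {a p q p′ q′} → p′ ≤ a * q′ → (p , q) ≺ (p′ , q′) → p < a * q
≺-ratio-upper {a} {p} {q} {p′} {q′} p′≤aq′ lt = *-cancelʳ-< q′ p (a * q) (begin-strict
  p * q′      <⟨ lt ⟩
  p′ * q      ≤⟨ *-monoˡ-≤ q p′≤aq′ ⟩
  a * q′ * q  ≡⟨ *-rightComm a q′ q ⟩
  a * q * q′  ∎)
  where open ≤-Reasoning

squeezed-multiples⇒≡ : ∀ {a c p q} → 1 ≤ a → 1 ≤ c →
                       (a ∸ 1) * q < p → p < a * q → (c ∸ 1) * q ≤ p → p ≤ c * q → c ≡ a
squeezed-multiples⇒≡ {suc a} {suc c} {p} {q} _ _ lo-a hi-a lo-c hi-c =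
  ≤-antisym (*-cancelʳ-< q c (suc a) (≤-<-trans lo-c hi-a)) (*-cancelʳ-< q a (suc c) (<-≤-trans lo-a hi-c))

-- For admissible u the ratio p/q of step b u = (p , q) lies in [b − 1 , b], which pins down the entry.
step-between⇒≡ : ∀ {a c U C V} → 2 ≤ a → 2 ≤ c → Admissible U → Admissible C →
                 step a U ≺ step c C → step c C ≺ step a V → c ≡ a
step-between⇒≡ {a} {c} {pU , qU} {pC , qC} {pV , qV} a≥2 c≥2 (qU≤pU , _) (qC≤pC , _) lo hi =
  squeezed-multiples⇒≡ 1≤a 1≤c
    (≺-ratio-lower {a ∸ 1} {a * pU ∸ qU} {pU} ([b∸1]*p≤b*p∸q 1≤a qU≤pU) lo)
    (≺-ratio-upper {a} {c * pC ∸ qC} {pC} {a * pV ∸ qV} {pV} (m∸n≤m (a * pV) qV) hi)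
    ([b∸1]*p≤b*p∸q 1≤c qC≤pC)
    (m∸n≤m (c * pC) qC)
  where
  1≤a = ≤-trans (s≤s z≤n) a≥2
  1≤c = ≤-trans (s≤s z≤n) c≥2

step-between : ∀ {a c U C V} → 2 ≤ a → 2 ≤ c → Admissible U → Admissible C → Admissible V →
               step a U ≺ step c C → step c C ≺ step a V → c ≡ a × U ≺ C × C ≺ V
step-between {a} {c} {U} {C} {V} a≥2 c≥2 U-adm C-adm V-adm lo hi
  with refl ← step-between⇒≡ {a} {c} {U} {C} {V} a≥2 c≥2 U-adm C-adm lo hi
  = refl , to (step-≺-iff a qU qC) lo , to (step-≺-iff a qC qV) hi
  where
  qU = admissible⇒q≤b*p a≥2 U-adm
  qC = admissible⇒q≤b*p a≥2 C-adm
  qV = admissible⇒q≤b*p a≥2 V-adm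

between⇒prefix : ∀ {u v} as cs → All (2 ≤_) as → All (2 ≤_) cs → Admissible u → Admissible v →
                 foldr step u as ≺ foldr step 1ₚ cs → foldr step 1ₚ cs ≺ foldr step v as →
                 ∃ λ ds → cs ≡ as ++ ds × u ≺ foldr step 1ₚ ds × foldr step 1ₚ ds ≺ v
between⇒prefix []       cs _ _ _ _ lo hi = cs , refl , lo , hi
between⇒prefix {v = v} (a ∷ as) [] _ _ _ _ _ hi = ⊥-elim (1ₚ-maximal {foldr step v (a ∷ as)} hi)
between⇒prefix {u} {v} (a ∷ as) (c ∷ cs) (a≥2 ∷ as≥2) (c≥2 ∷ cs≥2) u-adm v-adm lo hi
  with refl , lo′ , hi′ ← step-between {a} {c} {foldr step u as} {foldr step 1ₚ cs} {foldr step v as} a≥2 c≥2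
                            (foldr-step-admissible as≥2 u-adm) (foldr-step-admissible cs≥2 1ₚ-admissible)
                            (foldr-step-admissible as≥2 v-adm) lo hi
  with ds , refl , lo″ , hi″ ← between⇒prefix as cs as≥2 cs≥2 u-adm v-adm lo′ hi′
  = ds , refl , lo″ , hi″

sum-gap-below : ∀ bs cs → All (2 ≤_) bs → All (2 ≤_) cs →
                foldr step 0ₚ bs ≺ foldr step 1ₚ cs → foldr step 1ₚ cs ≺ foldr step 1ₚ bs →
                sum bs + 2 ≤ sum cs
sum-gap-below bs cs bs≥2 cs≥2 lo hi with between⇒prefix bs cs bs≥2 cs≥2 0ₚ-admissible 1ₚ-admissible lo hi
... | []     , _    , _ , hi′ = ⊥-elim (1ₚ-maximal {1ₚ} hi′)
... | d ∷ ds , refl , _ , _   = begin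
  sum bs + 2                ≤⟨ +-monoʳ-≤ (sum bs) (≤-trans d≥2 (m≤m+n d (sum ds))) ⟩
  sum bs + sum (d ∷ ds)     ≡⟨ sum-++ bs (d ∷ ds) ⟨
  sum (bs ++ d ∷ ds)        ∎
  where
  open ≤-Reasoning
  d≥2 = All.head (++⁻ʳ bs cs≥2)

sum-gap-above : ∀ as l cs → All (2 ≤_) (as ∷ʳ l) → All (2 ≤_) cs →
                foldr step 1ₚ (as ∷ʳ l) ≺ foldr step 1ₚ cs → foldr step 1ₚ cs ≺ foldr step 1ₚ as →
                sum (as ∷ʳ l) + 1 ≤ sum cs
sum-gap-above as l cs asl≥2 cs≥2 lo hi
  with between⇒prefix as cs as≥2 cs≥2 (step-admissible l≥2 1ₚ-admissible) 1ₚ-admissible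
         (subst (_≺ foldr step 1ₚ cs) (foldr-∷ʳ step 1ₚ l as) lo) hi
  where
  as≥2 = proj₁ (∷ʳ⁻ asl≥2)
  l≥2  = proj₂ (∷ʳ⁻ asl≥2)
... | []     , _    , _   , hi′ = ⊥-elim (1ₚ-maximal {1ₚ} hi′)
... | d ∷ ds , refl , lo′ , _   = begin
  sum (as ∷ʳ l) + 1         ≡⟨ cong (_+ 1) (sum-++ as (l ∷ [])) ⟩
  sum as + (l + 0) + 1      ≡⟨ cong (λ t → sum as + t + 1) (+-identityʳ l) ⟩
  sum as + l + 1            ≡⟨ +-assoc (sum as) l 1 ⟩
  sum as + (l + 1)          ≤⟨ +-monoʳ-≤ (sum as) (≤-trans (≤-reflexive (+-comm l 1)) (≤-trans l<d (m≤m+n d (sum ds)))) ⟩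
  sum as + sum (d ∷ ds)     ≡⟨ sum-++ as (d ∷ ds) ⟨
  sum (as ++ d ∷ ds)        ∎
  where
  open ≤-Reasoning
  D = foldr step 1ₚ ds
  l<d : l < d
  l<d = *-cancelʳ-< (proj₁ D) l d (<-≤-trans
          (≺-ratio-lower {l} {l * 1} {1} {d * proj₁ D ∸ proj₂ D} {proj₁ D} ≤-refl lo′)
          (m∸n≤m (d * proj₁ D) (proj₂ D)))

step-0ₚ-cases : ∀ b → 2 ≤ b →
                step b 0ₚ ≡ 0ₚ ⊎ ∃ λ c → 2 ≤ c × c < b × foldr step 1ₚ (c ∷ []) ≡ step b 0ₚ
step-0ₚ-cases 2                   _ = inj₁ refl
step-0ₚ-cases (suc (suc (suc k))) _ = inj₂ (suc (suc k) , s≤s (s≤s z≤n) , ≤-refl , refl)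
step-0ₚ-cases 1                   (s≤s ())

-- foldr step 0ₚ bs lowers the last entry of bs by one; an entry that drops to 1 is absorbed
-- by its predecessor, and an expansion consisting of 2s collapses to the pair of 0.
0ₚ-or-expansion : ∀ bs → All (2 ≤_) bs →
                  foldr step 0ₚ bs ≡ 0ₚ ⊎
                  ∃ λ ps → All (2 ≤_) ps × sum ps < sum bs × foldr step 1ₚ ps ≡ foldr step 0ₚ bs
0ₚ-or-expansion []       []            = inj₁ refl
0ₚ-or-expansion (b ∷ bs) (b≥2 ∷ bs≥2) with 0ₚ-or-expansion bs bs≥2
... | inj₂ (ps , ps≥2 , ps<bs , eq) = inj₂ (b ∷ ps , b≥2 ∷ ps≥2 , +-monoʳ-< b ps<bs , cong (step b) eq)
... | inj₁ eq with step-0ₚ-cases b b≥2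
...   | inj₁ eq′ = inj₁ (trans (cong (step b) eq) eq′)
...   | inj₂ (c , c≥2 , c<b , eq′) =
  inj₂ (c ∷ [] , c≥2 ∷ [] , ≤-trans (s≤s (≤-reflexive (+-identityʳ c))) (≤-trans c<b (m≤m+n b (sum bs))) ,
        trans eq′ (cong (step b) (sym eq)))

-- Rationals denoted by pairs

-- Represents is the cross-multiplied form used by IsExpansion; Denotes pins down the
-- numerator and denominator of the rational, i.e. requires (p − q)/p to be in lowest terms.
Represents : ℕ × ℕ → ℚ → Set
Represents (p , q) x = ↥ x ℤ.* + p ≡ + (p ∸ q) ℤ.* ℚ.↧ x

Denotes : ℕ × ℕ → ℚ → Set
Denotes (p , q) x = ↥ x ≡ + (p ∸ q) × ↧ₙ x ≡ p

0ℚ-denotes : Denotes 0ₚ 0ℚ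
0ℚ-denotes = refl , refl

1ℚ-denotes : Denotes 1ₚ 1ℚ
1ℚ-denotes = refl , refl

denotes-unique : ∀ {u x w} → Denotes u x → Denotes u w → x ≡ w
denotes-unique {p , q} {mkℚ _ _ _} {mkℚ _ _ _} (refl , refl) (refl , refl) = refl

denoted : ∀ {u} → Admissible u → Reduced u → ∃ (Denotes u)
denoted {suc p , q} _ reduced = mkℚ (+ (suc p ∸ q)) p reduced , refl , refl

represents⇒denotes : ∀ {x u} → Admissible u → Reduced u → Represents u x → Denotes u x
represents⇒denotes {x@record{}} {suc p , q} _ reduced eq = cong ↥_ x≡ , cong ↧ₙ_ x≡
  where
  open ≡-Reasoning
  x≡ : x ≡ mkℚ (+ (suc p ∸ q)) p reduced
  x≡ = begin
    x                                 ≡⟨ fromℚᵘ-toℚᵘ x ⟨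
    ℚ.fromℚᵘ (ℚ.toℚᵘ x)               ≡⟨ fromℚᵘ-cong {ℚ.toℚᵘ x} {mkℚᵘ (+ (suc p ∸ q)) p} (*≡* eq) ⟩
    ℚ.fromℚᵘ (mkℚᵘ (+ (suc p ∸ q)) p) ≡⟨ normalize-coprime reduced ⟩
    mkℚ (+ (suc p ∸ q)) p reduced     ∎

denotes⇒represents : ∀ {x u} → Denotes u x → Represents u x
denotes⇒represents {mkℚ _ _ _} (refl , refl) = refl

+*+<+*+⇔*<* : ∀ {a b c d} → + a ℤ.* + b ℤ.< + c ℤ.* + d ⇔ a * b < c * d
+*+<+*+⇔*<* {a} {b} {c} {d} = mk⇔
  (λ lt → ℤP.drop‿+<+ (subst₂ ℤ._<_ (sym (ℤP.pos-* a b)) (sym (ℤP.pos-* c d)) lt))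
  (λ lt → subst₂ ℤ._<_ (ℤP.pos-* a b) (ℤP.pos-* c d) (ℤ.+<+ lt))

denotes-<-iff : ∀ {u v x w} → Admissible u → Admissible v → Denotes u x → Denotes v w → x ℚ.< w ⇔ u ≺ v
denotes-<-iff {p , q} {p′ , q′} {mkℚ _ _ _} {mkℚ _ _ _} (q≤p , _) (q′≤p′ , _) (refl , refl) (refl , refl) =
  ⇔.trans (mk⇔ (λ { (ℚ.*<* lt) → lt }) ℚ.*<*)
    (⇔.trans (+*+<+*+⇔*<* {p ∸ q} {p′} {p′ ∸ q′} {p})
             (cross-≺-iff {1} (numerator+q≡1*p q≤p) (numerator+q≡1*p q′≤p′)))
  where
  numerator+q≡1*p : ∀ {m n} → n ≤ m → (m ∸ n) + n ≡ 1 * m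
  numerator+q≡1*p {m} n≤m = trans (m∸n+n≡m n≤m) (sym (*-identityˡ m))

⊕-denotes : ∀ {u v x w} → Admissible u → Admissible v → Reduced (u +ₚ v) →
            Denotes u x → Denotes v w → Denotes (u +ₚ v) (x ⊕ w)
⊕-denotes {p , q} {p′ , q′} {mkℚ _ d _} {mkℚ _ d′ _} (q≤p , _) (q′≤p′ , _) reduced (refl , refl) (refl , refl) =
  cong ↥_ x⊕w≡ , cong ↧ₙ_ x⊕w≡
  where
  x⊕w≡ : (+ (suc d ∸ q) ℤ.+ + (suc d′ ∸ q′)) / suc (d + suc d′)
         ≡ mkℚ (+ (suc d + suc d′ ∸ (q + q′))) (d + suc d′) reduced
  x⊕w≡ = trans (cong (λ n → + n / suc (d + suc d′)) (sym (+-∸-interchange q≤p q′≤p′))) (normalize-coprime reduced)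

-- The sets Θ k and Ξ n in terms of expansions

expansion⇒Θ : ∀ {k x} cs → All (2 ≤_) cs → sum cs ≡ suc k → Denotes (foldr step 1ₚ cs) x → Θ k x
expansion⇒Θ {x = x} (c ∷ cs) c∷cs≥2 sum≡ dx =
  from (denotes-<-iff 0ₚ-admissible C-adm 0ℚ-denotes dx) (proj₁ (expansion-in-unit-interval c∷cs≥2)) ,
  from (denotes-<-iff C-adm 1ₚ-admissible dx 1ℚ-denotes) (proj₂ (expansion-in-unit-interval c∷cs≥2)) ,
  c ∷ cs ,
  (c∷cs≥2 , denotes⇒represents {x} {cfPair (c ∷ cs)} (subst (λ u → Denotes u x) (sym (cfPair≡foldr (c ∷ cs))) dx)) ,
  sum≡
  where C-adm = foldr-step-admissible c∷cs≥2 1ₚ-admissible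

expansion⇒Ξ : ∀ {n x} cs → All (2 ≤_) cs → sum cs ≤ suc n → Denotes (foldr step 1ₚ cs) x → Ξ n x
expansion⇒Ξ []                 _      _         dx = inj₂ (inj₁ (denotes-unique {1ₚ} dx 1ℚ-denotes))
expansion⇒Ξ (suc (suc c) ∷ cs) c∷cs≥2 (s≤s k≤n) dx =
  inj₂ (inj₂ (suc (c + sum cs) , s≤s z≤n , k≤n , expansion⇒Θ _ c∷cs≥2 refl dx))
expansion⇒Ξ (1 ∷ _) (s≤s () ∷ _) _ _
expansion⇒Ξ (0 ∷ _) (() ∷ _)     _ _

Θ⇒snoc-expansion : ∀ {k y} → Θ k y →
                   ∃₂ λ as l → All (2 ≤_) (as ∷ʳ l) × sum (as ∷ʳ l) ≡ suc k × Denotes (foldr step 1ₚ (as ∷ʳ l)) y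
Θ⇒snoc-expansion {k} {y} (_ , _ , cs@(_ ∷ _) , (cs≥2 , represents) , sum≡) =
  snoc (initLast cs) cs≥2 sum≡
    (subst (λ u → Denotes u y) (cfPair≡foldr cs) (represents⇒denotes {y} {cfPair cs} C-adm C-reduced represents))
  where
  C-adm = subst Admissible (sym (cfPair≡foldr cs)) (foldr-step-admissible cs≥2 1ₚ-admissible)
  C-reduced = subst Reduced (sym (cfPair≡foldr cs)) (expansion-reduced cs≥2)
  snoc : ∀ {bs} → InitLast bs → All (2 ≤_) bs → sum bs ≡ suc k → Denotes (foldr step 1ₚ bs) y →
         ∃₂ λ as l → All (2 ≤_) (as ∷ʳ l) × sum (as ∷ʳ l) ≡ suc k × Denotes (foldr step 1ₚ (as ∷ʳ l)) y
  snoc (as ∷ʳ′ l) bs≥2 sum≡ dy = as , l , bs≥2 , sum≡ , dy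

Ξ⇒denotes : ∀ {n w} → Ξ n w →
            Denotes 0ₚ w ⊎ ∃ λ cs → All (2 ≤_) cs × sum cs ≤ suc n × Denotes (foldr step 1ₚ cs) w
Ξ⇒denotes (inj₁ refl)        = inj₁ 0ℚ-denotes
Ξ⇒denotes (inj₂ (inj₁ refl)) = inj₂ ([] , [] , z≤n , 1ℚ-denotes)
Ξ⇒denotes (inj₂ (inj₂ (k , _ , k≤n , θ))) with Θ⇒snoc-expansion θ
... | as , l , asl≥2 , sum≡ , dw = inj₂ (as ∷ʳ l , asl≥2 , ≤-trans (≤-reflexive sum≡) (s≤s k≤n) , dw)

-- Neighbours and mediants

predecessor-unique : ∀ {n x x′ y} → ConsecutiveIn n x y → ConsecutiveIn n x′ y → x ≡ x′
predecessor-unique {x = x} {x′} (Ξx , _ , x<y , nothing-between) (Ξx′ , _ , x′<y , nothing-between′) with ℚP.<-cmp x x′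
... | tri< x<x′ _ _ = ⊥-elim (nothing-between x′ Ξx′ (x<x′ , x′<y))
... | tri≈ _ x≡x′ _ = x≡x′
... | tri> _ _ x′<x = ⊥-elim (nothing-between′ x Ξx (x′<x , x<y))

successor-unique : ∀ {n y z z′} → ConsecutiveIn n y z → ConsecutiveIn n y z′ → z ≡ z′
successor-unique {z = z} {z′} (_ , Ξz , y<z , nothing-between) (_ , Ξz′ , y<z′ , nothing-between′) with ℚP.<-cmp z z′
... | tri< z<z′ _ _ = ⊥-elim (nothing-between′ z Ξz (y<z , z<z′))
... | tri≈ _ z≡z′ _ = z≡z′
... | tri> _ _ z′<z = ⊥-elim (nothing-between z′ Ξz′ (y<z′ , z′<z))

left-neighbour : ∀ {n x y} bs → All (2 ≤_) bs → sum bs ≡ suc n → Ξ n y →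
                 Denotes (foldr step 0ₚ bs) x → Denotes (foldr step 1ₚ bs) y → ConsecutiveIn n x y
left-neighbour {n} {x} {y} bs bs≥2 sum≡ Ξy dx dy = Ξx , Ξy , x<y , nothing-between
  where
  X-adm = foldr-step-admissible bs≥2 0ₚ-admissible
  Y-adm = foldr-step-admissible bs≥2 1ₚ-admissible
  Ξx : Ξ n x
  Ξx with 0ₚ-or-expansion bs bs≥2
  ... | inj₁ X≡0ₚ = inj₁ (denotes-unique {0ₚ} (subst (λ u → Denotes u x) X≡0ₚ dx) 0ℚ-denotes)
  ... | inj₂ (ps , ps≥2 , ps<bs , eq) =
    expansion⇒Ξ ps ps≥2 (≤-trans (<⇒≤ ps<bs) (≤-reflexive sum≡)) (subst (λ u → Denotes u x) (sym eq) dx)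
  x<y : x ℚ.< y
  x<y = from (denotes-<-iff X-adm Y-adm dx dy) (unimodular⇒≺ {foldr step 0ₚ bs} {foldr step 1ₚ bs} (expansion-unimodular bs≥2))
  nothing-between : ∀ w → Ξ n w → ¬ (x ℚ.< w × w ℚ.< y)
  nothing-between w Ξw (x<w , w<y) with Ξ⇒denotes Ξw
  ... | inj₁ dw = admissible-≮0ₚ X-adm (to (denotes-<-iff X-adm 0ₚ-admissible dx dw) x<w)
  ... | inj₂ (cs , cs≥2 , sum≤ , dw) = m+1+n≰m (sum bs) (begin
    sum bs + 2   ≤⟨ sum-gap-below bs cs bs≥2 cs≥2 (to (denotes-<-iff X-adm W-adm dx dw) x<w)
                                                   (to (denotes-<-iff W-adm Y-adm dw dy) w<y) ⟩
    sum cs       ≤⟨ sum≤ ⟩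
    suc n        ≡⟨ sum≡ ⟨
    sum bs       ∎)
    where
    open ≤-Reasoning
    W-adm = foldr-step-admissible cs≥2 1ₚ-admissible

right-neighbour : ∀ {n y z} as l → All (2 ≤_) (as ∷ʳ l) → sum (as ∷ʳ l) ≡ suc n → Ξ n y →
                  Denotes (foldr step 1ₚ (as ∷ʳ l)) y → Denotes (foldr step 1ₚ as) z → ConsecutiveIn n y z
right-neighbour {n} {y} {z} as l asl≥2 sum≡ Ξy dy dz = Ξy , Ξz , y<z , nothing-between
  where
  as≥2 = proj₁ (∷ʳ⁻ asl≥2)
  l≥2  = proj₂ (∷ʳ⁻ asl≥2)
  Y-adm = foldr-step-admissible asl≥2 1ₚ-admissible
  Z-adm = foldr-step-admissible as≥2 1ₚ-admissible
  Ξz : Ξ n z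
  Ξz = expansion⇒Ξ as as≥2 (begin
    sum as             ≤⟨ m≤m+n (sum as) (l + 0) ⟩
    sum as + (l + 0)   ≡⟨ sum-++ as (l ∷ []) ⟨
    sum (as ∷ʳ l)      ≡⟨ sum≡ ⟩
    suc n              ∎) dz
    where open ≤-Reasoning
  Y≺Z : foldr step 1ₚ (as ∷ʳ l) ≺ foldr step 1ₚ as
  Y≺Z = subst (_≺ foldr step 1ₚ as) (sym (foldr-∷ʳ step 1ₚ l as))
          (unimodular⇒≺ {foldr step (step l 1ₚ) as} {foldr step 1ₚ as}
            (foldr-step-unimodular as≥2 (step-admissible l≥2 1ₚ-admissible) 1ₚ-admissible (cong (_+ 1) (*-zeroʳ (l * 1)))))
  y<z : y ℚ.< z
  y<z = from (denotes-<-iff Y-adm Z-adm dy dz) Y≺Z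
  nothing-between : ∀ w → Ξ n w → ¬ (y ℚ.< w × w ℚ.< z)
  nothing-between w Ξw (y<w , w<z) with Ξ⇒denotes Ξw
  ... | inj₁ dw = admissible-≮0ₚ Y-adm (to (denotes-<-iff Y-adm 0ₚ-admissible dy dw) y<w)
  ... | inj₂ (cs , cs≥2 , sum≤ , dw) = m+1+n≰m (sum (as ∷ʳ l)) (begin
    sum (as ∷ʳ l) + 1   ≤⟨ sum-gap-above as l cs asl≥2 cs≥2 (to (denotes-<-iff Y-adm W-adm dy dw) y<w)
                                                          (to (denotes-<-iff W-adm Z-adm dw dz) w<z) ⟩
    sum cs              ≤⟨ sum≤ ⟩
    suc n               ≡⟨ sum≡ ⟨
    sum (as ∷ʳ l)       ∎)
    where
    open ≤-Reasoning
    W-adm = foldr-step-admissible cs≥2 1ₚ-admissible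

predecessor-denotes : ∀ {n x y} bs → All (2 ≤_) bs → sum bs ≡ suc n →
                      Denotes (foldr step 1ₚ bs) y → ConsecutiveIn n x y → Denotes (foldr step 0ₚ bs) x
predecessor-denotes bs bs≥2 sum≡ dy x⋖y@(_ , Ξy , _)
  with x′ , dx′ ← denoted {foldr step 0ₚ bs} (foldr-step-admissible bs≥2 0ₚ-admissible)
                    (unimodular⇒reducedˡ {foldr step 0ₚ bs} {foldr step 1ₚ bs}
                      (foldr-step-admissible bs≥2 0ₚ-admissible) (expansion-unimodular bs≥2))
  = subst (Denotes (foldr step 0ₚ bs)) (sym (predecessor-unique x⋖y (left-neighbour {x = x′} bs bs≥2 sum≡ Ξy dx′ dy))) dx′

successor-denotes : ∀ {n y z} as l → All (2 ≤_) (as ∷ʳ l) → sum (as ∷ʳ l) ≡ suc n →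
                    Denotes (foldr step 1ₚ (as ∷ʳ l)) y → ConsecutiveIn n y z → Denotes (foldr step 1ₚ as) z
successor-denotes as l asl≥2 sum≡ dy y⋖z@(Ξy , _)
  with as≥2 , _ ← ∷ʳ⁻ asl≥2
  with z′ , dz′ ← denoted {foldr step 1ₚ as} (foldr-step-admissible as≥2 1ₚ-admissible) (expansion-reduced {as} as≥2)
  = subst (Denotes (foldr step 1ₚ as)) (sym (successor-unique y⋖z (right-neighbour {z = z′} as l asl≥2 sum≡ Ξy dy dz′))) dz′

left-mediant : ∀ {n x y} bs → All (2 ≤_) bs → sum bs ≡ suc n →
               Denotes (foldr step 0ₚ bs) x → Denotes (foldr step 1ₚ bs) y → Θ (suc (suc n)) (x ⊕ y)
left-mediant {n} {x} {y} bs bs≥2 sum≡ dx dy =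
  expansion⇒Θ {x = x ⊕ y} (bs ∷ʳ 2) child≥2 child-sum
    (subst (λ u → Denotes u (x ⊕ y)) (sym child-pair) (⊕-denotes {x = x} {w = y} X-adm Y-adm child-reduced dx dy))
  where
  X-adm = foldr-step-admissible bs≥2 0ₚ-admissible
  Y-adm = foldr-step-admissible bs≥2 1ₚ-admissible
  child≥2 = ∷ʳ⁺ bs≥2 ≤-refl
  child-pair : foldr step 1ₚ (bs ∷ʳ 2) ≡ foldr step 0ₚ bs +ₚ foldr step 1ₚ bs
  child-pair = trans (foldr-∷ʳ step 1ₚ 2 bs) (foldr-step-+ bs≥2 0ₚ-admissible 1ₚ-admissible)
  child-reduced = subst Reduced child-pair (expansion-reduced {bs ∷ʳ 2} child≥2)
  child-sum : sum (bs ∷ʳ 2) ≡ suc (suc (suc n))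
  child-sum = trans (sum-++ bs (2 ∷ [])) (trans (cong (_+ 2) sum≡) (+-comm (suc n) 2))

right-mediant : ∀ {n y z} as l → All (2 ≤_) (as ∷ʳ l) → sum (as ∷ʳ l) ≡ suc n →
                Denotes (foldr step 1ₚ (as ∷ʳ l)) y → Denotes (foldr step 1ₚ as) z → Θ (suc n) (y ⊕ z)
right-mediant {n} {y} {z} as l asl≥2 sum≡ dy dz =
  expansion⇒Θ {x = y ⊕ z} (as ∷ʳ suc l) child≥2 child-sum
    (subst (λ u → Denotes u (y ⊕ z)) (sym child-pair) (⊕-denotes {x = y} {w = z} Y-adm Z-adm child-reduced dy dz))
  where
  as≥2 = proj₁ (∷ʳ⁻ asl≥2)
  l≥2  = proj₂ (∷ʳ⁻ asl≥2)
  Y-adm = foldr-step-admissible asl≥2 1ₚ-admissible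
  Z-adm = foldr-step-admissible as≥2 1ₚ-admissible
  child≥2 = ∷ʳ⁺ as≥2 (m≤n⇒m≤1+n l≥2)
  child-pair : foldr step 1ₚ (as ∷ʳ suc l) ≡ foldr step 1ₚ (as ∷ʳ l) +ₚ foldr step 1ₚ as
  child-pair = begin
    foldr step 1ₚ (as ∷ʳ suc l)                   ≡⟨ foldr-∷ʳ step 1ₚ (suc l) as ⟩
    foldr step (step (suc l) 1ₚ) as               ≡⟨ cong (λ t → foldr step (t , 1) as) (+-comm 1 (l * 1)) ⟩
    foldr step (step l 1ₚ +ₚ 1ₚ) as               ≡⟨ foldr-step-+ as≥2 (step-admissible l≥2 1ₚ-admissible) 1ₚ-admissible ⟩
    foldr step (step l 1ₚ) as +ₚ foldr step 1ₚ as  ≡⟨ cong (_+ₚ foldr step 1ₚ as) (foldr-∷ʳ step 1ₚ l as) ⟨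
    foldr step 1ₚ (as ∷ʳ l) +ₚ foldr step 1ₚ as   ∎
    where open ≡-Reasoning
  child-reduced = subst Reduced child-pair (expansion-reduced {as ∷ʳ suc l} child≥2)
  child-sum : sum (as ∷ʳ suc l) ≡ suc (suc n)
  child-sum = begin
    sum (as ∷ʳ suc l)        ≡⟨ sum-++ as (suc l ∷ []) ⟩
    sum as + suc (l + 0)     ≡⟨ +-suc (sum as) (l + 0) ⟩
    suc (sum as + (l + 0))   ≡⟨ cong suc (sum-++ as (l ∷ [])) ⟨
    suc (sum (as ∷ʳ l))      ≡⟨ cong suc sum≡ ⟩
    suc (suc n)              ∎
    where open ≡-Reasoning

lemma3 : (n : ℕ) → 1 ≤ n → (x y z : ℚ) →
         ConsecutiveIn n x y → ConsecutiveIn n y z → Θ n y →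
         Θ (suc (suc n)) (x ⊕ y) × Θ (suc n) (y ⊕ z)
lemma3 n _ x y z x⋖y y⋖z θy with as , l , asl≥2 , sum≡ , dy ← Θ⇒snoc-expansion θy =
  left-mediant {x = x} {y} (as ∷ʳ l) asl≥2 sum≡ (predecessor-denotes (as ∷ʳ l) asl≥2 sum≡ dy x⋖y) dy ,
  right-mediant {y = y} {z} as l asl≥2 sum≡ dy (successor-denotes as l asl≥2 sum≡ dy y⋖z)
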